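{- For any $J\subseteq[n]$, the number of $J$-Nietzschean permutations in $\mathfrak{S}_n$ is $|\mathfrak{N}_J|=\prod_{i=1}^n\mathrm{st}(J)_i$.
   Context: A permutation $w\in\mathfrak{S}_n$ (in one-line notation $w(1),\dots,w(n)$) is $j$-resentful if $w(j)=n$ or the value $w(j)+1$ appears among $w(j+1),\dots,w(n)$; it is $j$-Nietzschean otherwise. For $J\subseteq[n]$, $w$ is $J$-Nietzschean if it is $j$-Nietzschean for all $j\in J$; $\mathfrak{N}_J$ is the set of these. The $J$-staircase: $\mathrm{st}(J)_1=0$ if $1\in J$, else $1$; $\mathrm{st}(J)_{i+1}=\mathrm{st}(J)_i$ if $i+1\in J$, else $\mathrm{st}(J)_i+1$. -}

module Defs where

open import Data.Nat using (ℕ; zero; suc; _+_; _*_; _<_)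
open import Data.Bool using (Bool; true; false; if_then_else_)
open import Data.Fin using (Fin; toℕ)
open import Data.Fin.Subset using (Subset; _∈_; _∉_)
open import Data.Vec using (Vec; []; _∷_; lookup; allFin)
open import Data.List using (List; []; _∷_; length; filter; concatMap; map)
open import Data.Product using (_×_; ∃-syntax)
open import Data.Sum using (_⊎_)
open import Relation.Nullary using (¬_; Dec)
open import Relation.Unary using (Decidable)
open import Relation.Binary.PropositionalEquality using (_≡_)
open import Function.Definitions using (Injective)

-- Positions and values are 0-indexed: position j ∈ Fin n stands for j+1 ∈ [n],
-- value v ∈ Fin n stands for v+1 ∈ [n].  A permutation in one-line notation is a
-- vector w : Vec (Fin n) n whose entries are pairwise distinct (injective).

IsPerm : ∀ {n} → Vec (Fin n) n → Set
IsPerm {n} w = Injective _≡_ _≡_ (lookup w)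

Resentful : ∀ {n} → Vec (Fin n) n → Fin n → Set
Resentful {n} w j =
  (suc (toℕ (lookup w j)) ≡ n)
  ⊎ (∃[ k ] (toℕ j < toℕ k × toℕ (lookup w k) ≡ suc (toℕ (lookup w j))))

Nietzschean : ∀ {n} → Vec (Fin n) n → Fin n → Set
Nietzschean w j = ¬ Resentful w j

JNietzschean : ∀ {n} → Subset n → Vec (Fin n) n → Set
JNietzschean {n} J w = ∀ (j : Fin n) → j ∈ J → Nietzschean w j

allWords : ∀ n m → List (Vec (Fin n) m)
allWords n zero = [] ∷ []
allWords n (suc m) =
  concatMap (λ x → map (x ∷_) (allWords n m)) (Data.Vec.toList (allFin n))

countNJ : ∀ n (J : Subset n) →
  Decidable (λ (w : Vec (Fin n) n) → IsPerm w × JNietzschean J w) → ℕ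
countNJ n J dec = length (filter dec (allWords n n))

staircaseFrom : ∀ {m} → ℕ → Subset m → Vec ℕ m
staircaseFrom s [] = []
staircaseFrom s (b ∷ J) =
  let s' = if b then s else suc s in s' ∷ staircaseFrom s' J

staircase : ∀ {n} → Subset n → Vec ℕ n
staircase J = staircaseFrom 0 J

prodVec : ∀ {m} → Vec ℕ m → ℕ
prodVec [] = 1
prodVec (x ∷ xs) = x * prodVec xs

-- A permutation w of [m+1] is determined by its last entry v and the permutation w′ of
-- [m] obtained by standardising its other entries.  A position j ≤ m of w is resentful
-- iff it is resentful in w′ or v = w′(j)+1, and position m+1 is resentful iff v = m+1.
-- Hence w is J-Nietzschean iff w′ is (J ∩ [m])-Nietzschean and v avoids the values
-- w′(j)+1 for j ∈ J, j ≤ m, and also m+1 if m+1 ∈ J.  For such w′ these values are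
-- pairwise distinct, so v has m+1 − |J| = st(J)_{m+1} choices; induct on n.
module Submission where

open import Defs
open import Data.Nat using (ℕ; zero; suc; _+_; _*_; _∸_; _≤_; _<_; z≤n; s≤s)
open import Data.Nat.Properties
  using (suc-injective; +-identityʳ; +-comm; +-suc; *-comm; *-assoc; m+n∸n≡m; <⇒≱)
  renaming (_≟_ to _≟ℕ_)
open import Data.Bool using (true; false)
open import Data.Fin using (Fin; zero; suc; toℕ; fromℕ; inject₁; punchIn; punchOut)
open import Data.Fin.Properties
  using (toℕ-injective; toℕ-inject₁; toℕ-fromℕ; toℕ<n; toℕ≤pred[n]; inject₁-injective;
         fromℕ≢inject₁; punchIn-injective; punchInᵢ≢i; punchIn-punchOut; any?; _≟_)
import Data.Fin.Properties as Fin
open import Data.Fin.Relation.Unary.Top using (view; ‵fromℕ; ‵inject₁)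
open import Data.Fin.Subset using (Subset; _∈_; ∣_∣; ∁)
open import Data.Fin.Subset.Properties using (_∈?_; ∣∁p∣≡n∸∣p∣)
open import Data.Vec using (Vec; []; _∷_; here; there; lookup; _∷ʳ_; init; tabulate)
  renaming ([_] to [_]ᵥ)
import Data.Vec as Vec
open import Data.Vec.Properties
  using (lookup-map; ∷ʳ-injective; ∷-injectiveˡ; ∷-injectiveʳ; lookup∘tabulate)
open import Data.Vec.Membership.Propositional.Properties using (∈-toList⁺; ∈-allFin⁺)
open import Data.Vec.Relation.Binary.Pointwise.Extensional using (ext; Pointwise-≡⇒≡)
open import Data.List using (List; []; _∷_; length; filter; concatMap; _++_; [_])
import Data.List as List
open import Data.List.Properties using (length-++; length-map; length-tabulate; map-tabulate)
open import Data.List.Membership.Propositional using (find; lose) renaming (_∈_ to _∈ₗ_)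
open import Data.List.Membership.Propositional.Properties
  using (∈-map⁺; ∈-map⁻; ∈-concatMap⁺; ∈-concatMap⁻; ∈-filter⁺; ∈-filter⁻; ∈-allFin;
         ∈-++⁺ˡ; ∈-++⁺ʳ)
open import Data.List.Membership.Propositional.Properties.WithK using (unique∧set⇒bag)
open import Data.List.Relation.Binary.BagAndSetEquality using (∼bag⇒↭)
open import Data.List.Relation.Binary.Permutation.Propositional.Properties using (↭-length)
open import Data.List.Relation.Unary.Any using (here; there)
import Data.List.Relation.Unary.All as All
import Data.List.Relation.Unary.All.Properties as All
import Data.List.Relation.Unary.AllPairs as AllPairs
import Data.List.Relation.Unary.AllPairs.Properties as AllPairs
open import Data.List.Relation.Unary.Unique.Propositional using (Unique; []; _∷_)
open import Data.List.Relation.Unary.Unique.Propositional.Properties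
  using (map⁺; ++⁺; concat⁺; allFin⁺; filter⁺)
open import Data.Product using (_×_; _,_; proj₁; proj₂; ∃-syntax)
import Data.Product as Product
open import Data.Sum using (_⊎_; inj₁; inj₂)
open import Data.Empty using (⊥-elim)
open import Function using (_∘_; id)
open import Function.Bundles using (_⇔_; mk⇔; Equivalence)
import Function.Properties.Equivalence as ⇔
open import Relation.Nullary using (¬_; yes; no)
open import Relation.Nullary.Decidable using (_×-dec_; ¬?)
open import Relation.Unary using (Decidable)
open import Relation.Binary.PropositionalEquality
  using (_≡_; _≢_; refl; sym; trans; cong; cong₂; subst; subst₂; module ≡-Reasoning)

open Equivalence using (to; from)

-- Counting duplicate-free lists

module _ {a} {A : Set a} where

  length-unique-⇔ : {xs ys : List A} → Unique xs → Unique ys →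
                     (∀ {z} → z ∈ₗ xs ⇔ z ∈ₗ ys) → length xs ≡ length ys
  length-unique-⇔ ux uy xs⇔ys = ↭-length (∼bag⇒↭ (unique∧set⇒bag ux uy xs⇔ys))

  module _ {b} {B : Set b} where

    Unique-map⁺ : {f : B → A} {xs : List B} →
                  (∀ {x y} → x ∈ₗ xs → y ∈ₗ xs → f x ≡ f y → x ≡ y) →
                  Unique xs → Unique (List.map f xs)
    Unique-map⁺ f-inj [] = []
    Unique-map⁺ f-inj (x∉xs ∷ xs!) =
      All.map⁺ (All.tabulate λ y∈xs fx≡fy →
                  All.lookup x∉xs y∈xs (f-inj (here refl) (there y∈xs) fx≡fy))
      ∷ Unique-map⁺ (λ x∈ y∈ → f-inj (there x∈) (there y∈)) xs!

    Unique-concatMap⁺ : {f : B → List A} {xs : List B} → Unique xs →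
                        (∀ x → Unique (f x)) →
                        (∀ {x y z} → z ∈ₗ f x → z ∈ₗ f y → x ≡ y) →
                        Unique (concatMap f xs)
    Unique-concatMap⁺ {xs = xs} xs! f! f-disjoint =
      concat⁺ (All.map⁺ (All.universal f! xs))
              (AllPairs.map⁺ (AllPairs.map (λ x≢y {_} (p , q) → x≢y (f-disjoint p q)) xs!))

    length-concatMap-const : (f : B → List A) {c : ℕ} (xs : List B) →
                             (∀ {x} → x ∈ₗ xs → length (f x) ≡ c) →
                             length (concatMap f xs) ≡ length xs * c
    length-concatMap-const f []       _   = refl
    length-concatMap-const f (x ∷ xs) len =
      trans (length-++ (f x))
            (cong₂ _+_ (len (here refl)) (length-concatMap-const f xs (len ∘ there)))

  toList-tabulate : ∀ {n} (f : Fin n → A) → Vec.toList (tabulate f) ≡ List.tabulate f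
  toList-tabulate {zero}  f = refl
  toList-tabulate {suc n} f = cong (f zero ∷_) (toList-tabulate (f ∘ suc))

  lookup-∷ʳ-inject₁ : ∀ {n} (xs : Vec A n) x i → lookup (xs ∷ʳ x) (inject₁ i) ≡ lookup xs i
  lookup-∷ʳ-inject₁ (y ∷ xs) x zero    = refl
  lookup-∷ʳ-inject₁ (y ∷ xs) x (suc i) = lookup-∷ʳ-inject₁ xs x i

  lookup-∷ʳ-fromℕ : ∀ {n} (xs : Vec A n) x → lookup (xs ∷ʳ x) (fromℕ n) ≡ x
  lookup-∷ʳ-fromℕ []       x = refl
  lookup-∷ʳ-fromℕ (y ∷ xs) x = lookup-∷ʳ-fromℕ xs x

allWords-complete : ∀ {n m} (w : Vec (Fin n) m) → w ∈ₗ allWords n m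
allWords-complete []           = here refl
allWords-complete {n} (x ∷ w) =
  ∈-concatMap⁺ (λ y → List.map (y ∷_) (allWords n _))
    (lose (∈-toList⁺ (∈-allFin⁺ x)) (∈-map⁺ (x ∷_) (allWords-complete w)))

allWords-unique : ∀ n m → Unique (allWords n m)
allWords-unique n zero    = All.[] ∷ []
allWords-unique n (suc m) =
  Unique-concatMap⁺ (subst Unique (sym (toList-tabulate id)) (allFin⁺ n))
    (λ x → map⁺ ∷-injectiveʳ (allWords-unique n m)) heads-agree
  where
  heads-agree : ∀ {x y z} → z ∈ₗ List.map (x ∷_) (allWords n m) →
                z ∈ₗ List.map (y ∷_) (allWords n m) → x ≡ y
  heads-agree p q with ∈-map⁻ (_ ∷_) p | ∈-map⁻ (_ ∷_) q
  ... | _ , _ , refl | _ , _ , e = ∷-injectiveˡ e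

∈-filter-allWords : ∀ {n m p} {P : Vec (Fin n) m → Set p} (P? : Decidable P) {w} →
                    w ∈ₗ filter P? (allWords n m) ⇔ P w
∈-filter-allWords {n} {m} P? = mk⇔ (λ w∈ → proj₂ (∈-filter⁻ P? {xs = allWords n m} w∈))
                                   (∈-filter⁺ P? (allWords-complete _))

-- Subsets and the staircase

filter-∈?-map-suc : ∀ {k} b (S : Subset k) xs →
                    filter (_∈? (b ∷ S)) (List.map suc xs) ≡ List.map suc (filter (_∈? S) xs)
filter-∈?-map-suc b S []       = refl
filter-∈?-map-suc b S (x ∷ xs) with x ∈? S
... | yes _ = cong (suc x ∷_) (filter-∈?-map-suc b S xs)
... | no  _ = filter-∈?-map-suc b S xs

length-filter-∈?-allFin : ∀ {k} (S : Subset k) → length (filter (_∈? S) (List.allFin k)) ≡ ∣ S ∣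
length-filter-∈?-tail : ∀ {k} b (S : Subset k) →
                        length (filter (_∈? (b ∷ S)) (List.tabulate suc)) ≡ ∣ S ∣

length-filter-∈?-allFin []          = refl
length-filter-∈?-allFin (true  ∷ S) = cong suc (length-filter-∈?-tail true S)
length-filter-∈?-allFin (false ∷ S) = length-filter-∈?-tail false S

length-filter-∈?-tail {k} b S = begin
  length (filter (_∈? (b ∷ S)) (List.tabulate suc))
    ≡⟨ cong (length ∘ filter (_∈? (b ∷ S))) (map-tabulate id suc) ⟨
  length (filter (_∈? (b ∷ S)) (List.map suc (List.allFin k)))
    ≡⟨ cong length (filter-∈?-map-suc b S (List.allFin k)) ⟩
  length (List.map suc (filter (_∈? S) (List.allFin k)))
    ≡⟨ length-map suc (filter (_∈? S) (List.allFin k)) ⟩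
  length (filter (_∈? S) (List.allFin k))
    ≡⟨ length-filter-∈?-allFin S ⟩
  ∣ S ∣ ∎
  where open ≡-Reasoning

inject₁∈⇒∈init : ∀ {m} {J : Subset (suc m)} {j : Fin m} → inject₁ j ∈ J → j ∈ init J
inject₁∈⇒∈init {J = _ ∷ _ ∷ _} {zero}  here      = here
inject₁∈⇒∈init {J = _ ∷ _ ∷ _} {suc j} (there p) = there (inject₁∈⇒∈init p)

∈init⇒inject₁∈ : ∀ {m} {J : Subset (suc m)} {j : Fin m} → j ∈ init J → inject₁ j ∈ J
∈init⇒inject₁∈ {J = _ ∷ _ ∷ _} {zero}  here      = here
∈init⇒inject₁∈ {J = _ ∷ _ ∷ _} {suc j} (there p) = there (∈init⇒inject₁∈ p)

staircaseFrom-init : ∀ {m} s (J : Subset (suc m)) →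
                     staircaseFrom s J ≡ staircaseFrom s (init J) ∷ʳ (s + ∣ ∁ J ∣)
staircaseFrom-init s (true  ∷ [])        = cong [_]ᵥ (sym (+-identityʳ s))
staircaseFrom-init s (false ∷ [])        = cong [_]ᵥ (+-comm 1 s)
staircaseFrom-init s (true  ∷ J@(_ ∷ _)) = cong (s ∷_) (staircaseFrom-init s J)
staircaseFrom-init s (false ∷ J@(_ ∷ _)) =
  cong (suc s ∷_) (trans (staircaseFrom-init (suc s) J)
                         (cong (staircaseFrom (suc s) (init J) ∷ʳ_) (sym (+-suc s ∣ ∁ J ∣))))

prodVec-∷ʳ : ∀ {m} (xs : Vec ℕ m) x → prodVec (xs ∷ʳ x) ≡ prodVec xs * x
prodVec-∷ʳ []       x = *-comm x 1
prodVec-∷ʳ (y ∷ xs) x = trans (cong (y *_) (prodVec-∷ʳ xs x)) (sym (*-assoc y (prodVec xs) x))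

prodVec-staircase-init : ∀ {m} (J : Subset (suc m)) →
                         prodVec (staircase J) ≡ prodVec (staircase (init J)) * ∣ ∁ J ∣
prodVec-staircase-init J =
  trans (cong prodVec (staircaseFrom-init 0 J)) (prodVec-∷ʳ (staircase (init J)) ∣ ∁ J ∣)

-- Counting values outside an image

module _ {k} (S : Subset k) (g : Fin k → Fin k) where

  InImage : Fin k → Set
  InImage v = ∃[ i ] i ∈ S × g i ≡ v

  inImage? : Decidable InImage
  inImage? v = any? (λ i → i ∈? S ×-dec g i ≟ v)

  outsideImage? : Decidable (¬_ ∘ InImage)
  outsideImage? = ¬? ∘ inImage?

  outsideImage : List (Fin k)
  outsideImage = filter outsideImage? (List.allFin k)

  ∈-outsideImage : ∀ {v} → v ∈ₗ outsideImage ⇔ (¬ InImage v)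
  ∈-outsideImage = mk⇔ (λ p → proj₂ (∈-filter⁻ outsideImage? {xs = List.allFin k} p))
                       (∈-filter⁺ outsideImage? (∈-allFin _))

  outsideImage-unique : Unique outsideImage
  outsideImage-unique = filter⁺ outsideImage? (allFin⁺ k)

  length-outsideImage : (∀ {i j} → i ∈ S → j ∈ S → g i ≡ g j → i ≡ j) →
                        length outsideImage ≡ ∣ ∁ S ∣
  length-outsideImage g-inj = begin
    length outsideImage                     ≡⟨ m+n∸n≡m (length outsideImage) ∣ S ∣ ⟨
    length outsideImage + ∣ S ∣ ∸ ∣ S ∣       ≡⟨ cong (_∸ ∣ S ∣) outside+image≡k ⟩
    k ∸ ∣ S ∣                                ≡⟨ ∣∁p∣≡n∸∣p∣ S ⟨
    ∣ ∁ S ∣                                  ∎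
    where
    open ≡-Reasoning
    members : List (Fin k)
    members = filter (_∈? S) (List.allFin k)

    image : List (Fin k)
    image = List.map g members

    member⇒∈S : ∀ {i} → i ∈ₗ members → i ∈ S
    member⇒∈S p = proj₂ (∈-filter⁻ (_∈? S) {xs = List.allFin k} p)

    image! : Unique image
    image! = Unique-map⁺ (λ p q → g-inj (member⇒∈S p) (member⇒∈S q))
                         (filter⁺ (_∈? S) (allFin⁺ k))

    disjoint : ∀ {v} → ¬ (v ∈ₗ outsideImage × v ∈ₗ image)
    disjoint (p , q) with ∈-map⁻ g q
    ... | i , i∈members , refl = to ∈-outsideImage p (i , member⇒∈S i∈members , refl)

    covers : ∀ {v} → v ∈ₗ List.allFin k → v ∈ₗ outsideImage ++ image
    covers {v} _ with inImage? v
    ... | yes (i , i∈S , refl) =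
      ∈-++⁺ʳ outsideImage (∈-map⁺ g (∈-filter⁺ (_∈? S) (∈-allFin i) i∈S))
    ... | no  v∉image          = ∈-++⁺ˡ (from ∈-outsideImage v∉image)

    outside+image≡k : length outsideImage + ∣ S ∣ ≡ k
    outside+image≡k = begin
      length outsideImage + ∣ S ∣
        ≡⟨ cong (length outsideImage +_)
                (trans (length-map g members) (length-filter-∈?-allFin S)) ⟨
      length outsideImage + length image
        ≡⟨ length-++ outsideImage ⟨
      length (outsideImage ++ image)
        ≡⟨ length-unique-⇔ (++⁺ outsideImage-unique image! disjoint) (allFin⁺ k)
                            (mk⇔ (λ _ → ∈-allFin _) covers) ⟩
      length (List.allFin k)
        ≡⟨ length-tabulate id ⟩
      k ∎

-- Extending a permutation by a last entry

punchInℕ : ℕ → ℕ → ℕ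
punchInℕ zero    x       = suc x
punchInℕ (suc v) zero    = zero
punchInℕ (suc v) (suc x) = suc (punchInℕ v x)

toℕ-punchIn : ∀ {m} (v : Fin (suc m)) (x : Fin m) → toℕ (punchIn v x) ≡ punchInℕ (toℕ v) (toℕ x)
toℕ-punchIn zero    x       = refl
toℕ-punchIn (suc v) zero    = refl
toℕ-punchIn (suc v) (suc x) = cong suc (toℕ-punchIn v x)

punchInℕ-≥ : ∀ {v x : ℕ} → v ≤ x → punchInℕ v x ≡ suc x
punchInℕ-≥ {zero}          z≤n       = refl
punchInℕ-≥ {suc v} {suc x} (s≤s v≤x) = cong suc (punchInℕ-≥ v≤x)

punchInℕ-pred : ∀ (x : ℕ) → punchInℕ (suc x) x ≡ x
punchInℕ-pred zero    = refl
punchInℕ-pred (suc x) = cong suc (punchInℕ-pred x)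

punchInℕ-suc⁻ : ∀ (v x y : ℕ) → punchInℕ v y ≡ suc (punchInℕ v x) → y ≡ suc x × v ≢ suc x
punchInℕ-suc⁻ zero          x       y             eq   = suc-injective eq , λ ()
punchInℕ-suc⁻ (suc v)       zero    zero          ()
punchInℕ-suc⁻ (suc zero)    zero    (suc y)       ()
punchInℕ-suc⁻ (suc (suc v)) zero    (suc zero)    refl = refl , λ ()
punchInℕ-suc⁻ (suc (suc v)) zero    (suc (suc y)) ()
punchInℕ-suc⁻ (suc v)       (suc x) zero          ()
punchInℕ-suc⁻ (suc v)       (suc x) (suc y)       eq   =
  Product.map (cong suc) (λ v≢ → v≢ ∘ suc-injective) (punchInℕ-suc⁻ v x y (suc-injective eq))

punchInℕ-suc⁺ : ∀ (v x : ℕ) → v ≢ suc x → punchInℕ v (suc x) ≡ suc (punchInℕ v x)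
punchInℕ-suc⁺ zero          x       _   = refl
punchInℕ-suc⁺ (suc zero)    zero    v≢1 = ⊥-elim (v≢1 refl)
punchInℕ-suc⁺ (suc (suc v)) zero    _   = refl
punchInℕ-suc⁺ (suc v)       (suc x) v≢  = cong suc (punchInℕ-suc⁺ v x (v≢ ∘ cong suc))

suc-punchInℕ⁻ : ∀ (v x : ℕ) → v ≡ suc (punchInℕ v x) → v ≡ suc x
suc-punchInℕ⁻ zero    x       ()
suc-punchInℕ⁻ (suc v) zero    eq = eq
suc-punchInℕ⁻ (suc v) (suc x) eq = cong suc (suc-punchInℕ⁻ v x (suc-injective eq))

extend : ∀ {m} → Fin (suc m) → Vec (Fin m) m → Vec (Fin (suc m)) (suc m)
extend v w′ = Vec.map (punchIn v) w′ ∷ʳ v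

module _ {m} (v : Fin (suc m)) (w′ : Vec (Fin m) m) where

  lookup-extend-inject₁ : ∀ j → lookup (extend v w′) (inject₁ j) ≡ punchIn v (lookup w′ j)
  lookup-extend-inject₁ j =
    trans (lookup-∷ʳ-inject₁ (Vec.map (punchIn v) w′) v j) (lookup-map j (punchIn v) w′)

  lookup-extend-fromℕ : lookup (extend v w′) (fromℕ m) ≡ v
  lookup-extend-fromℕ = lookup-∷ʳ-fromℕ (Vec.map (punchIn v) w′) v

  isPerm-extend : IsPerm w′ → IsPerm (extend v w′)
  isPerm-extend w′-perm {i} {j} eq with view i | view j
  ... | ‵fromℕ      | ‵fromℕ      = refl
  ... | ‵fromℕ      | ‵inject₁ j′ =
    ⊥-elim (punchInᵢ≢i v _
      (sym (trans (sym lookup-extend-fromℕ) (trans eq (lookup-extend-inject₁ j′)))))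
  ... | ‵inject₁ i′ | ‵fromℕ      =
    ⊥-elim (punchInᵢ≢i v _ (trans (sym (lookup-extend-inject₁ i′)) (trans eq lookup-extend-fromℕ)))
  ... | ‵inject₁ i′ | ‵inject₁ j′ =
    cong inject₁ (w′-perm (punchIn-injective v _ _
      (trans (sym (lookup-extend-inject₁ i′)) (trans eq (lookup-extend-inject₁ j′)))))

  isPerm-extend⁻ : IsPerm (extend v w′) → IsPerm w′
  isPerm-extend⁻ w-perm {i} {j} eq = inject₁-injective (w-perm (begin
    lookup (extend v w′) (inject₁ i) ≡⟨ lookup-extend-inject₁ i ⟩
    punchIn v (lookup w′ i)          ≡⟨ cong (punchIn v) eq ⟩
    punchIn v (lookup w′ j)          ≡⟨ lookup-extend-inject₁ j ⟨
    lookup (extend v w′) (inject₁ j) ∎))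
    where open ≡-Reasoning

extend-injective : ∀ {m} {v u : Fin (suc m)} {w′ u′ : Vec (Fin m) m} →
                   extend v w′ ≡ extend u u′ → v ≡ u × w′ ≡ u′
extend-injective {v = v} {w′ = w′} {u′ = u′} eq
  with ∷ʳ-injective (Vec.map (punchIn v) w′) _ eq
... | maps≡ , refl = refl , Pointwise-≡⇒≡ (ext λ i → punchIn-injective v _ _ (begin
  punchIn v (lookup w′ i)           ≡⟨ lookup-map i (punchIn v) w′ ⟨
  lookup (Vec.map (punchIn v) w′) i ≡⟨ cong (λ xs → lookup xs i) maps≡ ⟩
  lookup (Vec.map (punchIn v) u′) i ≡⟨ lookup-map i (punchIn v) u′ ⟩
  punchIn v (lookup u′ i)           ∎))
  where open ≡-Reasoning

extend-surjective : ∀ {m} {w : Vec (Fin (suc m)) (suc m)} → IsPerm w →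
                    ∃[ v ] ∃[ w′ ] extend v w′ ≡ w
extend-surjective {m} {w} w-perm = v , w′ , Pointwise-≡⇒≡ (ext agree)
  where
  v : Fin (suc m)
  v = lookup w (fromℕ m)

  v≢ : ∀ k → v ≢ lookup w (inject₁ k)
  v≢ k = fromℕ≢inject₁ ∘ w-perm

  w′ : Vec (Fin m) m
  w′ = tabulate (λ k → punchOut (v≢ k))

  agree : ∀ i → lookup (extend v w′) i ≡ lookup w i
  agree i with view i
  ... | ‵fromℕ     = lookup-extend-fromℕ v w′
  ... | ‵inject₁ k = begin
    lookup (extend v w′) (inject₁ k) ≡⟨ lookup-extend-inject₁ v w′ k ⟩
    punchIn v (lookup w′ k)          ≡⟨ cong (punchIn v) (lookup∘tabulate _ k) ⟩
    punchIn v (punchOut (v≢ k))      ≡⟨ punchIn-punchOut (v≢ k) ⟩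
    lookup w (inject₁ k)             ∎
    where open ≡-Reasoning

module _ {m} (v : Fin (suc m)) (w′ : Vec (Fin m) m) where

  private
    w : Vec (Fin (suc m)) (suc m)
    w = extend v w′

    value : ∀ k → toℕ (lookup w (inject₁ k)) ≡ punchInℕ (toℕ v) (toℕ (lookup w′ k))
    value k = trans (cong toℕ (lookup-extend-inject₁ v w′ k)) (toℕ-punchIn v (lookup w′ k))

    last-value : toℕ (lookup w (fromℕ m)) ≡ toℕ v
    last-value = cong toℕ (lookup-extend-fromℕ v w′)

    top-value : punchInℕ (toℕ v) m ≡ suc m
    top-value = punchInℕ-≥ (toℕ≤pred[n] v)

    inject₁-<-fromℕ : ∀ (j : Fin m) → toℕ (inject₁ j) < toℕ (fromℕ m)
    inject₁-<-fromℕ j = subst₂ _<_ (sym (toℕ-inject₁ j)) (sym (toℕ-fromℕ m)) (toℕ<n j)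

  resentful-extend-fromℕ : Resentful w (fromℕ m) ⇔ toℕ v ≡ m
  resentful-extend-fromℕ = mk⇔ to′ from′
    where
    to′ : Resentful w (fromℕ m) → toℕ v ≡ m
    to′ (inj₁ e)             = suc-injective (trans (cong suc (sym last-value)) e)
    to′ (inj₂ (k , m<k , _)) = ⊥-elim (<⇒≱ (subst (_< toℕ k) (toℕ-fromℕ m) m<k) (toℕ≤pred[n] k))
    from′ : toℕ v ≡ m → Resentful w (fromℕ m)
    from′ e = inj₁ (cong suc (trans last-value e))

  resentful-extend-inject₁⁻ : ∀ j → Resentful w (inject₁ j) →
                              Resentful w′ j ⊎ toℕ v ≡ suc (toℕ (lookup w′ j))
  resentful-extend-inject₁⁻ j (inj₁ e) =
    inj₁ (inj₁ (sym (proj₁ (punchInℕ-suc⁻ (toℕ v) _ m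
      (trans top-value (cong suc (trans (sym (suc-injective e)) (value j))))))))
  resentful-extend-inject₁⁻ j (inj₂ (k , j<k , e)) with view k
  ... | ‵fromℕ      =
    inj₂ (suc-punchInℕ⁻ (toℕ v) _ (trans (sym last-value) (trans e (cong suc (value j)))))
  ... | ‵inject₁ k′ =
    inj₁ (inj₂ (k′ , subst₂ _<_ (toℕ-inject₁ j) (toℕ-inject₁ k′) j<k ,
                proj₁ (punchInℕ-suc⁻ (toℕ v) _ _
                         (trans (sym (value k′)) (trans e (cong suc (value j)))))))

  resentful-extend-inject₁-last : ∀ j → toℕ v ≡ suc (toℕ (lookup w′ j)) → Resentful w (inject₁ j)
  resentful-extend-inject₁-last j v≡ = inj₂ (fromℕ m , inject₁-<-fromℕ j , (begin
    toℕ (lookup w (fromℕ m))         ≡⟨ last-value ⟩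
    toℕ v                            ≡⟨ v≡ ⟩
    suc x                            ≡⟨ cong suc (punchInℕ-pred x) ⟨
    suc (punchInℕ (suc x) x)         ≡⟨ cong (λ u → suc (punchInℕ u x)) v≡ ⟨
    suc (punchInℕ (toℕ v) x)         ≡⟨ cong suc (value j) ⟨
    suc (toℕ (lookup w (inject₁ j))) ∎))
    where
    open ≡-Reasoning
    x : ℕ
    x = toℕ (lookup w′ j)

  resentful-extend-inject₁⁺ : ∀ j → Resentful w′ j ⊎ toℕ v ≡ suc (toℕ (lookup w′ j)) →
                              Resentful w (inject₁ j)
  resentful-extend-inject₁⁺ j (inj₂ v≡) = resentful-extend-inject₁-last j v≡
  resentful-extend-inject₁⁺ j (inj₁ r) with toℕ v ≟ℕ suc (toℕ (lookup w′ j))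
  ... | yes v≡ = resentful-extend-inject₁-last j v≡
  ... | no  v≢ = lift r
    where
    step : ∀ {y} → y ≡ suc (toℕ (lookup w′ j)) →
           punchInℕ (toℕ v) y ≡ suc (punchInℕ (toℕ v) (toℕ (lookup w′ j)))
    step refl = punchInℕ-suc⁺ (toℕ v) _ v≢
    lift : Resentful w′ j → Resentful w (inject₁ j)
    lift (inj₁ e)             =
      inj₁ (cong suc (trans (value j) (suc-injective (trans (sym (step (sym e))) top-value))))
    lift (inj₂ (k , j<k , e)) =
      inj₂ (inject₁ k , subst₂ _<_ (sym (toℕ-inject₁ j)) (sym (toℕ-inject₁ k)) j<k ,
            trans (value k) (trans (step e) (cong suc (sym (value j)))))

  resentful-extend-inject₁ : ∀ j → Resentful w (inject₁ j) ⇔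
                             (Resentful w′ j ⊎ toℕ v ≡ suc (toℕ (lookup w′ j)))
  resentful-extend-inject₁ j = mk⇔ (resentful-extend-inject₁⁻ j) (resentful-extend-inject₁⁺ j)

-- J-Nietzschean permutations

𝔑 : ∀ {n} → Subset n → Vec (Fin n) n → Set
𝔑 J w = IsPerm w × JNietzschean J w

-- forbiddenLast w′ i is the last entry v that makes position i of extend v w′ resentful
-- although it is not resentful in w′ : suc (w′ j) for i = inject₁ j, and the top value
-- for the last position.
forbiddenLast : ∀ {m} → Vec (Fin m) m → Fin (suc m) → Fin (suc m)
forbiddenLast {m} w′ = lookup (Vec.map suc w′ ∷ʳ fromℕ m)

module _ {m} (w′ : Vec (Fin m) m) where

  forbiddenLast-inject₁ : ∀ j → forbiddenLast w′ (inject₁ j) ≡ suc (lookup w′ j)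
  forbiddenLast-inject₁ j =
    trans (lookup-∷ʳ-inject₁ (Vec.map suc w′) (fromℕ m) j) (lookup-map j suc w′)

  forbiddenLast-fromℕ : forbiddenLast w′ (fromℕ m) ≡ fromℕ m
  forbiddenLast-fromℕ = lookup-∷ʳ-fromℕ (Vec.map suc w′) (fromℕ m)

  forbiddenLast-inject₁≡⇔ : ∀ j {v} →
                            forbiddenLast w′ (inject₁ j) ≡ v ⇔ toℕ v ≡ suc (toℕ (lookup w′ j))
  forbiddenLast-inject₁≡⇔ j = mk⇔
    (λ e → cong toℕ (trans (sym e) (forbiddenLast-inject₁ j)))
    (λ e → toℕ-injective (trans (cong toℕ (forbiddenLast-inject₁ j)) (sym e)))

  forbiddenLast-fromℕ≡⇔ : ∀ {v} → forbiddenLast w′ (fromℕ m) ≡ v ⇔ toℕ v ≡ m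
  forbiddenLast-fromℕ≡⇔ = mk⇔
    (λ e → trans (cong toℕ (trans (sym e) forbiddenLast-fromℕ)) (toℕ-fromℕ m))
    (λ e → toℕ-injective (trans (cong toℕ forbiddenLast-fromℕ) (trans (toℕ-fromℕ m) (sym e))))

  forbiddenLast-inject₁≢fromℕ : ∀ j → Nietzschean w′ j →
                                forbiddenLast w′ (inject₁ j) ≢ forbiddenLast w′ (fromℕ m)
  forbiddenLast-inject₁≢fromℕ j nz e =
    nz (inj₁ (trans (sym (to (forbiddenLast-inject₁≡⇔ j) refl)) (to forbiddenLast-fromℕ≡⇔ (sym e))))

forbiddenLast-injectiveOn : ∀ {m} {J : Subset (suc m)} {w′} → 𝔑 (init J) w′ → ∀ {i j} →
                            i ∈ J → j ∈ J → forbiddenLast w′ i ≡ forbiddenLast w′ j → i ≡ j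
forbiddenLast-injectiveOn {m} {J} {w′} (w′-perm , w′-nz) {i} {j} i∈J j∈J eq with view i | view j
... | ‵fromℕ      | ‵fromℕ      = refl
... | ‵fromℕ      | ‵inject₁ j′ =
  ⊥-elim (forbiddenLast-inject₁≢fromℕ w′ j′ (w′-nz j′ (inject₁∈⇒∈init j∈J)) (sym eq))
... | ‵inject₁ i′ | ‵fromℕ      =
  ⊥-elim (forbiddenLast-inject₁≢fromℕ w′ i′ (w′-nz i′ (inject₁∈⇒∈init i∈J)) eq)
... | ‵inject₁ i′ | ‵inject₁ j′ =
  cong inject₁ (w′-perm (Fin.suc-injective
    (trans (sym (forbiddenLast-inject₁ w′ i′)) (trans eq (forbiddenLast-inject₁ w′ j′)))))

𝔑-extend : ∀ {m} (J : Subset (suc m)) v (w′ : Vec (Fin m) m) →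
           𝔑 J (extend v w′) ⇔ (𝔑 (init J) w′ × ¬ InImage J (forbiddenLast w′) v)
𝔑-extend {m} J v w′ = mk⇔ to′ from′
  where
  to′ : 𝔑 J (extend v w′) → 𝔑 (init J) w′ × ¬ InImage J (forbiddenLast w′) v
  to′ (w-perm , w-nz) = (isPerm-extend⁻ v w′ w-perm , w′-nz) , v-allowed
    where
    w′-nz : JNietzschean (init J) w′
    w′-nz j j∈ r =
      w-nz (inject₁ j) (∈init⇒inject₁∈ j∈) (from (resentful-extend-inject₁ v w′ j) (inj₁ r))
    v-allowed : ¬ InImage J (forbiddenLast w′) v
    v-allowed (i , i∈J , e) with view i
    ... | ‵fromℕ     =
      w-nz (fromℕ m) i∈J (from (resentful-extend-fromℕ v w′) (to (forbiddenLast-fromℕ≡⇔ w′) e))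
    ... | ‵inject₁ j =
      w-nz (inject₁ j) i∈J
        (from (resentful-extend-inject₁ v w′ j) (inj₂ (to (forbiddenLast-inject₁≡⇔ w′ j) e)))

  from′ : 𝔑 (init J) w′ × ¬ InImage J (forbiddenLast w′) v → 𝔑 J (extend v w′)
  from′ ((w′-perm , w′-nz) , v-allowed) = isPerm-extend v w′ w′-perm , w-nz
    where
    w-nz : JNietzschean J (extend v w′)
    w-nz i i∈J r with view i
    ... | ‵fromℕ =
      v-allowed (fromℕ m , i∈J , from (forbiddenLast-fromℕ≡⇔ w′) (to (resentful-extend-fromℕ v w′) r))
    ... | ‵inject₁ j with to (resentful-extend-inject₁ v w′ j) r
    ...   | inj₁ r′ = w′-nz j (inject₁∈⇒∈init i∈J) r′
    ...   | inj₂ e  = v-allowed (inject₁ j , i∈J , from (forbiddenLast-inject₁≡⇔ w′ j) e)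

extensions : ∀ {m} → Subset (suc m) → Vec (Fin m) m → List (Vec (Fin (suc m)) (suc m))
extensions J w′ = List.map (λ v → extend v w′) (outsideImage J (forbiddenLast w′))

nietzscheanPerms : ∀ {m} → Subset m → List (Vec (Fin m) m)
nietzscheanPerms {zero}  _ = [ [] ]
nietzscheanPerms {suc m} J = concatMap (extensions J) (nietzscheanPerms (init J))

∈-nietzscheanPerms : ∀ {m} (J : Subset m) {w} → w ∈ₗ nietzscheanPerms J ⇔ 𝔑 J w
∈-nietzscheanPerms {zero}  [] {[]} = mk⇔ (λ _ → (λ { {()} }) , λ ()) (λ _ → here refl)
∈-nietzscheanPerms {suc m} J       = mk⇔ to′ from′
  where
  to′ : ∀ {w} → w ∈ₗ nietzscheanPerms J → 𝔑 J w
  to′ w∈ with find (∈-concatMap⁻ (extensions J) {xs = nietzscheanPerms (init J)} w∈)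
  ... | w′ , w′∈ , w∈ext with ∈-map⁻ (λ v → extend v w′) w∈ext
  ... | v , v∈ , refl = from (𝔑-extend J v w′)
    (to (∈-nietzscheanPerms (init J)) w′∈ , to (∈-outsideImage J (forbiddenLast w′)) v∈)

  from′ : ∀ {w} → 𝔑 J w → w ∈ₗ nietzscheanPerms J
  from′ {w} w∈𝔑 with extend-surjective {w = w} (proj₁ w∈𝔑)
  ... | v , w′ , refl with to (𝔑-extend J v w′) w∈𝔑
  ... | w′∈𝔑 , v-allowed = ∈-concatMap⁺ (extensions J)
    (lose (from (∈-nietzscheanPerms (init J)) w′∈𝔑)
          (∈-map⁺ (λ u → extend u w′) (from (∈-outsideImage J (forbiddenLast w′)) v-allowed)))

nietzscheanPerms-unique : ∀ {m} (J : Subset m) → Unique (nietzscheanPerms J)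
nietzscheanPerms-unique {zero}  _ = All.[] ∷ []
nietzscheanPerms-unique {suc m} J =
  Unique-concatMap⁺ (nietzscheanPerms-unique (init J))
    (λ w′ → map⁺ (proj₁ ∘ extend-injective) (outsideImage-unique J (forbiddenLast w′)))
    same-base
  where
  same-base : ∀ {x y z} → z ∈ₗ extensions J x → z ∈ₗ extensions J y → x ≡ y
  same-base p q with ∈-map⁻ _ p | ∈-map⁻ _ q
  ... | _ , _ , refl | _ , _ , e = proj₂ (extend-injective e)

length-nietzscheanPerms : ∀ {m} (J : Subset m) → length (nietzscheanPerms J) ≡ prodVec (staircase J)
length-nietzscheanPerms {zero}  [] = refl
length-nietzscheanPerms {suc m} J  = begin
  length (nietzscheanPerms J)
    ≡⟨ length-concatMap-const (extensions J) (nietzscheanPerms (init J)) length-extensions ⟩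
  length (nietzscheanPerms (init J)) * ∣ ∁ J ∣
    ≡⟨ cong (_* ∣ ∁ J ∣) (length-nietzscheanPerms (init J)) ⟩
  prodVec (staircase (init J)) * ∣ ∁ J ∣
    ≡⟨ prodVec-staircase-init J ⟨
  prodVec (staircase J) ∎
  where
  open ≡-Reasoning
  length-extensions : ∀ {w′} → w′ ∈ₗ nietzscheanPerms (init J) → length (extensions J w′) ≡ ∣ ∁ J ∣
  length-extensions {w′} w′∈ =
    trans (length-map (λ v → extend v w′) (outsideImage J (forbiddenLast w′)))
          (length-outsideImage J (forbiddenLast w′)
            (forbiddenLast-injectiveOn {w′ = w′} (to (∈-nietzscheanPerms (init J)) w′∈)))

proposition4p11 : (n : ℕ) (J : Subset n)
    (dec : Decidable (λ (w : Vec (Fin n) n) → IsPerm w × JNietzschean J w)) →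
    countNJ n J dec ≡ prodVec (staircase J)
proposition4p11 n J dec = begin
  countNJ n J dec
    ≡⟨ length-unique-⇔ (filter⁺ dec (allWords-unique n n)) (nietzscheanPerms-unique J)
                        (⇔.trans (∈-filter-allWords dec) (⇔.sym (∈-nietzscheanPerms J))) ⟩
  length (nietzscheanPerms J)
    ≡⟨ length-nietzscheanPerms J ⟩
  prodVec (staircase J) ∎
  where open ≡-Reasoning
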